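{- Let $K_n$ be the complete graph on $n \geq 1$ vertices and $P_2$ the path on $2$ vertices. In the game of Hyperopic Cops and Robber on $K_n \square P_2$, two cops can choose starting positions from which they capture the robber in at most one move.
   Context: The Cartesian product $G \square J$ has vertex set $V(G) \times V(J)$, with $(x,y)$ adjacent to $(x',y')$ iff either $x = x'$ and $yy' \in E(J)$, or $y = y'$ and $xx' \in E(G)$. Hyperopic Cops and Robber on a graph $H$ (each vertex considered to carry a loop, so a player may stay put): the cops first occupy a multiset of vertices, then the robber chooses a vertex. In each round, each cop moves to an adjacent vertex or stays, then the robber moves to an adjacent vertex or stays. The robber always sees all cops. The cops see the robber's position except when the robber's vertex is adjacent to every vertex occupied by a cop, in which case the robber is invisible. The robber is captured when a cop occupies the robber's vertex. -}

module Defs where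

open import Data.Nat using (ℕ)
open import Data.Fin using (Fin)
open import Data.Product using (_×_; _,_; proj₁; proj₂)
open import Data.Sum using (_⊎_)
open import Relation.Binary.PropositionalEquality using (_≡_; _≢_)

record Graph : Set₁ where
  field
    V   : Set
    Adj : V → V → Set
open Graph public

K : ℕ → Graph
K n = record { V = Fin n ; Adj = λ i j → i ≢ j }

P₂ : Graph
P₂ = record { V = Fin 2 ; Adj = λ a b → a ≢ b }

_□_ : Graph → Graph → Graph
G □ J = record
  { V   = V G × V J
  ; Adj = λ p q → (proj₁ p ≡ proj₁ q × Adj J (proj₂ p) (proj₂ q))
                ⊎ (proj₂ p ≡ proj₂ q × Adj G (proj₁ p) (proj₁ q)) }

-- Adjacency with a loop at every vertex (closed neighbourhood):
-- the vertices a player at x may move to (including staying).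
Adjℓ : (G : Graph) → V G → V G → Set
Adjℓ G x y = x ≡ y ⊎ Adj G x y

Invisible : (G : Graph) → V G → V G → V G → Set
Invisible G c₁ c₂ r = Adjℓ G r c₁ × Adjℓ G r c₂

Caught : (G : Graph) → V G → V G → V G → Set
Caught G d₁ d₂ r = d₁ ≡ r ⊎ d₂ ≡ r

-- Two cops, starting at c₁ c₂, have a first-move strategy depending only
-- on what they observe: when the robber is visible at r they move to
-- vis r; when invisible they move to inv (they cannot see the robber).
CaptureWithinOneMove : (G : Graph) → V G → V G → Set
CaptureWithinOneMove G c₁ c₂ =
  Σ (V G → V G × V G) λ vis →
  Σ (V G × V G) λ inv →
    ((r : V G) → Adjℓ G c₁ (proj₁ (vis r)) × Adjℓ G c₂ (proj₂ (vis r)))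
  × (Adjℓ G c₁ (proj₁ inv) × Adjℓ G c₂ (proj₂ inv))
  × ((r : V G) →
        Caught G c₁ c₂ r
      ⊎ ((¬ Invisible G c₁ c₂ r) × Caught G (proj₁ (vis r)) (proj₂ (vis r)) r)
      ⊎ (Invisible G c₁ c₂ r × Caught G (proj₁ inv) (proj₂ inv) r))
  where
  open import Data.Product using (Σ)
  open import Relation.Nullary using (¬_)

TwoCopsCaptureWithinOneMove : Graph → Set
TwoCopsCaptureWithinOneMove G =
  Σ (V G) λ c₁ → Σ (V G) λ c₂ → CaptureWithinOneMove G c₁ c₂
  where open import Data.Product using (Σ)

-- Put both cops on the P₂-fibre of a dominating vertex x of G.  A robber
-- outside that fibre is adjacent to at most one of them, hence visible, and
-- the cops jump to the two vertices of the robber's fibre (each cop moves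
-- inside its copy of G, where x dominates).  A robber inside the fibre is
-- already caught.  In Kₙ every vertex is dominating.
module Submission where

open import Defs
open import Data.Nat using (ℕ; _≤_; suc; s≤s)
open import Data.Fin using (Fin; zero; suc)
open import Data.Fin.Properties using (_≟_)
open import Data.Product using (_×_; _,_; proj₁; proj₂)
open import Data.Sum using (_⊎_; inj₁; inj₂)
open import Relation.Nullary using (yes; no; ¬_)
open import Relation.Binary.Definitions using (DecidableEquality)
open import Relation.Binary.PropositionalEquality using (_≡_; refl; trans; sym; cong)

Adjℓ-K : ∀ {n} (i j : Fin n) → Adjℓ (K n) i j
Adjℓ-K i j with i ≟ j
... | yes i≡j = inj₁ i≡j
... | no  i≢j = inj₂ i≢j

module _ (G J : Graph) where

  Adjℓ-□ˡ : ∀ {x y b} → Adjℓ G x y → Adjℓ (G □ J) (x , b) (y , b)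
  Adjℓ-□ˡ (inj₁ refl) = inj₁ refl
  Adjℓ-□ˡ (inj₂ xy)   = inj₂ (inj₂ (refl , xy))

  Adjℓ-□⇒≡⊎≡ : ∀ {x y b c} → Adjℓ (G □ J) (x , b) (y , c) → x ≡ y ⊎ b ≡ c
  Adjℓ-□⇒≡⊎≡ (inj₁ e)               = inj₁ (cong proj₁ e)
  Adjℓ-□⇒≡⊎≡ (inj₂ (inj₁ (x≡y , _))) = inj₁ x≡y
  Adjℓ-□⇒≡⊎≡ (inj₂ (inj₂ (b≡c , _))) = inj₂ b≡c

module _ (G : Graph) where

  invisible⇒sameFibre : ∀ {x y b} →
    Invisible (G □ P₂) (x , zero) (x , suc zero) (y , b) → y ≡ x
  invisible⇒sameFibre (adj₀ , adj₁) with Adjℓ-□⇒≡⊎≡ G P₂ adj₀ | Adjℓ-□⇒≡⊎≡ G P₂ adj₁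
  ... | inj₁ y≡x | _        = y≡x
  ... | inj₂ _   | inj₁ y≡x = y≡x
  ... | inj₂ b≡0 | inj₂ b≡1 with trans (sym b≡0) b≡1
  ...   | ()

  fibreCatches : ∀ x b → Caught (G □ P₂) (x , zero) (x , suc zero) (x , b)
  fibreCatches x zero       = inj₁ refl
  fibreCatches x (suc zero) = inj₂ refl

  dominatingFibre-captureWithinOneMove :
    DecidableEquality (V G) →
    (x : V G) → (∀ y → Adjℓ G x y) →
    CaptureWithinOneMove (G □ P₂) (x , zero) (x , suc zero)
  dominatingFibre-captureWithinOneMove _≟ᵥ_ x dominates =
    jumpToFibre , ((x , zero) , (x , suc zero)) ,
    (λ { (y , _) → Adjℓ-□ˡ G P₂ (dominates y) , Adjℓ-□ˡ G P₂ (dominates y) }) ,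
    (inj₁ refl , inj₁ refl) ,
    outcome
    where
    jumpToFibre : V (G □ P₂) → V (G □ P₂) × V (G □ P₂)
    jumpToFibre (y , _) = (y , zero) , (y , suc zero)

    outcome : (r : V (G □ P₂)) →
        Caught (G □ P₂) (x , zero) (x , suc zero) r
      ⊎ ((¬ Invisible (G □ P₂) (x , zero) (x , suc zero) r)
          × Caught (G □ P₂) (proj₁ (jumpToFibre r)) (proj₂ (jumpToFibre r)) r)
      ⊎ (Invisible (G □ P₂) (x , zero) (x , suc zero) r
          × Caught (G □ P₂) (x , zero) (x , suc zero) r)
    outcome (y , b) with y ≟ᵥ x
    ... | yes refl = inj₁ (fibreCatches x b)
    ... | no  y≢x  = inj₂ (inj₁ ((λ inv → y≢x (invisible⇒sameFibre inv)) , fibreCatches y b))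

lemma5p4 : (n : ℕ) → 1 ≤ n → TwoCopsCaptureWithinOneMove (K n □ P₂)
lemma5p4 (suc m) (s≤s _) =
  (zero , zero) , (zero , suc zero) ,
  dominatingFibre-captureWithinOneMove (K (suc m)) _≟_ zero (Adjℓ-K zero)
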